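{- Let $m\ge2$, $k\ge1$, $g\ge0$, $n=m+g(m-1)$, and let $D,D'$ be $(m-1)$-Dyck paths of length $n-1$ with $d(D)=(d_1,\dots,d_n)$ and $d(D')=(d'_1,\dots,d'_n)$. If $D'$ is obtained from $D$ by a right $k$-compression, then there exist $1\le j<i\le n$ such that $d'_i=d_i+k(m-1)$, $d'_j=d_j-k(m-1)$, and $d'_h=d_h$ for all $h\ne i,j$.
   Context: $N$ denotes the unit step $(1,1)$, $S$ the step $(1,-1)$; lattice paths are identified with words in $N,S$. An $(m-1)$-Dyck path is a lattice path from $(0,0)$ with up-steps $(m-1,m-1)$ and down-steps $(1,-1)$, never below the $x$-axis and ending on it; its length is its number of down-steps. Every $(m-1)$-Dyck path $D$ of length $n-1$ is uniquely written $N^{d_1}SN^{d_2}S\dots SN^{d_{n-1}}SN^{d_n}$ with $d_i$ non-negative multiples of $m-1$ and $d_n=0$, and $d(D):=(d_1,\dots,d_n)$. Right $k$-compression: if $D$ contains as a consecutive subword a word $X=N^{m-1}D_1SD_2S\dots D_{j-1}SN^{k(m-1)}D_jSD_{j+1}S\dots SD_{m+k(m-1)}$, where $1\le j\le m-1$ and each $D_i$ is a (possibly empty) word which is an $(m-1)$-Dyck path (up to translation), replace $X$ by $X'=N^{m-1}D_1SD_2S\dots D_{j-1}SD_jSN^{k(m-1)}D_{j+1}S\dots SD_{m+k(m-1)}$. -}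

module Defs where

open import Data.Nat using (ℕ; zero; suc; _+_; _*_; _∸_; _≤_)
open import Data.List using (List; []; _∷_; _++_; replicate; intercalate; concatMap; length)
open import Data.List.Relation.Unary.All using (All)
open import Data.Product using (Σ; _×_; _,_; proj₁; proj₂)
open import Relation.Binary.PropositionalEquality using (_≡_)

-- Unit steps: N = (1,1), S = (1,-1). Lattice paths are words in N, S.
data Step : Set where
  N S : Step

Word : Set
Word = List Step

-- Steps of an (m-1)-Dyck path: U = (m-1,m-1), Dn = (1,-1).
data BigStep : Set where
  U Dn : BigStep

expand : ℕ → List BigStep → Word
expand a []        = []
expand a (U ∷ bs)  = replicate a N ++ expand a bs
expand a (Dn ∷ bs) = S ∷ expand a bs

-- Ballot a h bs : starting at height h, the path bs (up-steps of height a)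
-- never goes below the x-axis and ends on it.
data Ballot (a : ℕ) : ℕ → List BigStep → Set where
  end  : Ballot a 0 []
  up   : ∀ {h bs} → Ballot a (h + a) bs → Ballot a h (U ∷ bs)
  down : ∀ {h bs} → Ballot a h bs → Ballot a (suc h) (Dn ∷ bs)

IsDyck : ℕ → Word → Set
IsDyck m w = Σ (List BigStep) λ bs → Ballot (m ∸ 1) 0 bs × expand (m ∸ 1) bs ≡ w

-- Length of a Dyck path = number of down steps S.
countS : Word → ℕ
countS []      = 0
countS (N ∷ w) = countS w
countS (S ∷ w) = suc (countS w)

-- Write w = N^{d_1} S N^{d_2} S ... S N^{d_n}; dseq w = (d_1, ..., d_n).
dgo : Word → ℕ × List ℕ
dgo []      = 0 , []
dgo (N ∷ w) = suc (proj₁ (dgo w)) , proj₂ (dgo w)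
dgo (S ∷ w) = 0 , (proj₁ (dgo w) ∷ proj₂ (dgo w))

dseq : Word → List ℕ
dseq w = proj₁ (dgo w) ∷ proj₂ (dgo w)

-- 0-based list access with default 0 (only used at valid indices).
nth : List ℕ → ℕ → ℕ
nth []       _       = 0
nth (x ∷ xs) zero    = x
nth (x ∷ xs) (suc i) = nth xs i

-- 1-based: dAt w i = d_i for 1 ≤ i ≤ n.
dAt : Word → ℕ → ℕ
dAt w i = nth (dseq w) (i ∸ 1)

-- With Ds₁ = (D_1,...,D_{j-1}), Dj = D_j,
-- Ds₂ = (D_{j+1},...,D_{m+k(m-1)}):
--   X  = N^{m-1} D_1 S ... D_{j-1} S N^{k(m-1)} D_j S D_{j+1} S ... S D_{m+k(m-1)}
--   X' = N^{m-1} D_1 S ... D_{j-1} S D_j S N^{k(m-1)} D_{j+1} S ... S D_{m+k(m-1)}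
compX : ℕ → ℕ → List Word → Word → List Word → Word
compX m k Ds₁ Dj Ds₂ =
  replicate (m ∸ 1) N ++ concatMap (λ w → w ++ (S ∷ [])) Ds₁
    ++ replicate (k * (m ∸ 1)) N ++ intercalate (S ∷ []) (Dj ∷ Ds₂)

compX' : ℕ → ℕ → List Word → Word → List Word → Word
compX' m k Ds₁ Dj Ds₂ =
  replicate (m ∸ 1) N ++ concatMap (λ w → w ++ (S ∷ [])) Ds₁
    ++ Dj ++ (S ∷ []) ++ replicate (k * (m ∸ 1)) N ++ intercalate (S ∷ []) Ds₂

-- D' is obtained from D by a right k-compression: D = P X Q and D' = P X' Q,
-- with j = length Ds₁ + 1, 1 ≤ j ≤ m-1, m + k(m-1) Dyck words D_i in total.
data RightCompression (m k : ℕ) (D D' : Word) : Set where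
  rc : (P Q : Word) (Ds₁ : List Word) (Dj : Word) (Ds₂ : List Word) →
       suc (length Ds₁) ≤ m ∸ 1 →
       length Ds₁ + 1 + length Ds₂ ≡ m + k * (m ∸ 1) →
       All (IsDyck m) Ds₁ → IsDyck m Dj → All (IsDyck m) Ds₂ →
       D  ≡ P ++ compX  m k Ds₁ Dj Ds₂ ++ Q →
       D' ≡ P ++ compX' m k Ds₁ Dj Ds₂ ++ Q →
       RightCompression m k D D'

-- Write D = N^{d_1} S N^{d_2} S ⋯. Inserting a block N^r into a word right after its c-th
-- letter S adds r to d_{c+1} and changes nothing else. A right k-compression moves the block
-- N^{k(m-1)} from just before D_j to just after the S following D_j. Deleting that block leaves
-- the same word in D and in D', so d(D) and d(D') arise from one sequence by adding k(m-1) at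
-- two indices j < i, where i - j is the (positive) number of letters S in D_j S.
module Submission where

open import Data.Empty using (⊥-elim)
open import Data.List using (List; []; _∷_; _++_; replicate; intercalate; concatMap; length)
open import Data.List.Properties using (++-monoid)
open import Data.Nat using (ℕ; zero; suc; _+_; _*_; _∸_; _≤_; _<_; s≤s; z≤n)
open import Data.Nat.Properties
  using (module ≤-Reasoning; ≤-refl; +-suc; +-identityʳ; +-comm; +-monoʳ-≤;
         m<m+n; m≤m+n; m≤n+m; 1+n≰n; <-trans; <⇒≢; >⇒≢)
open import Data.Product using (Σ; _×_; _,_)
open import Relation.Binary.PropositionalEquality using (_≡_; _≢_; refl; sym; trans; cong; subst)

open import Defs
open import Algebra.Solver.Monoid (++-monoid Step) using (solve; _⊜_; _⊕_)

addAt : ℕ → ℕ → List ℕ → List ℕ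
addAt _       _ []       = []
addAt zero    r (x ∷ xs) = r + x ∷ xs
addAt (suc c) r (x ∷ xs) = x ∷ addAt c r xs

nth-addAt-≡ : ∀ c r xs → c < length xs → nth (addAt c r xs) c ≡ nth xs c + r
nth-addAt-≡ zero    r (x ∷ xs) _       = +-comm r x
nth-addAt-≡ (suc c) r (x ∷ xs) (s≤s c<) = nth-addAt-≡ c r xs c<

nth-addAt-≢ : ∀ c r xs t → t ≢ c → nth (addAt c r xs) t ≡ nth xs t
nth-addAt-≢ c       r []       t       t≢c = refl
nth-addAt-≢ zero    r (x ∷ xs) zero    t≢c = ⊥-elim (t≢c refl)
nth-addAt-≢ zero    r (x ∷ xs) (suc t) t≢c = refl
nth-addAt-≢ (suc c) r (x ∷ xs) zero    t≢c = refl
nth-addAt-≢ (suc c) r (x ∷ xs) (suc t) t≢c = nth-addAt-≢ c r xs t (λ t≡c → t≢c (cong suc t≡c))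

length-addAt : ∀ c r xs → length (addAt c r xs) ≡ length xs
length-addAt _       r []       = refl
length-addAt zero    r (x ∷ xs) = refl
length-addAt (suc c) r (x ∷ xs) = cong suc (length-addAt c r xs)

countS-++ : ∀ A B → countS (A ++ B) ≡ countS A + countS B
countS-++ []      B = refl
countS-++ (N ∷ A) B = countS-++ A B
countS-++ (S ∷ A) B = cong suc (countS-++ A B)

length-dseq : ∀ w → length (dseq w) ≡ suc (countS w)
length-dseq []      = refl
length-dseq (N ∷ w) = length-dseq w
length-dseq (S ∷ w) = cong suc (length-dseq w)

-- dseq (N ∷ w) is definitionally addAt 0 1 (dseq w).
dseq-replicateN : ∀ r B → dseq (replicate r N ++ B) ≡ addAt 0 r (dseq B)
dseq-replicateN zero    B = refl
dseq-replicateN (suc r) B = cong (addAt 0 1) (dseq-replicateN r B)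

addAt-incHead : ∀ c r xs → addAt c r (addAt 0 1 xs) ≡ addAt 0 1 (addAt c r xs)
addAt-incHead _       r []       = refl
addAt-incHead zero    r (x ∷ xs) = cong (_∷ xs) (+-suc r x)
addAt-incHead (suc c) r (x ∷ xs) = refl

dseq-++-addAt : ∀ A {Z Z' c r} → dseq Z ≡ addAt c r (dseq Z') →
                dseq (A ++ Z) ≡ addAt (countS A + c) r (dseq (A ++ Z'))
dseq-++-addAt []      eq = eq
dseq-++-addAt (N ∷ A) {Z' = Z'} {c} {r} eq =
  trans (cong (addAt 0 1) (dseq-++-addAt A eq))
        (sym (addAt-incHead (countS A + c) r (dseq (A ++ Z'))))
dseq-++-addAt (S ∷ A) eq = cong (0 ∷_) (dseq-++-addAt A eq)

dseq-insertNs : ∀ A r B → dseq (A ++ replicate r N ++ B) ≡ addAt (countS A) r (dseq (A ++ B))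
dseq-insertNs A r B =
  subst (λ c → dseq (A ++ replicate r N ++ B) ≡ addAt c r (dseq (A ++ B)))
        (+-identityʳ (countS A)) (dseq-++-addAt A (dseq-replicateN r B))

TransfersRight : (n r : ℕ) (D D' : Word) → Set
TransfersRight n r D D' =
  Σ ℕ λ j → Σ ℕ λ i → 1 ≤ j × j < i × i ≤ n ×
    dAt D' i ≡ dAt D i + r ×
    dAt D j ≡ dAt D' j + r ×
    ((h : ℕ) → 1 ≤ h → h ≤ n → h ≢ i → h ≢ j → dAt D' h ≡ dAt D h)

addAt-transfersRight : ∀ {c c' r} (D D' : Word) xs →
                       dseq D ≡ addAt c r xs → dseq D' ≡ addAt c' r xs →
                       c < c' → c' < length xs → TransfersRight (length (dseq D)) r D D'
addAt-transfersRight {c} {c'} {r} D D' xs dD dD' c<c' c'<len =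
  suc c , suc c' , s≤s z≤n , s≤s c<c' , i≤n , at-i , at-j , elsewhere
  where
  i≤n : suc c' ≤ length (dseq D)
  i≤n = subst (suc c' ≤_) (sym (trans (cong length dD) (length-addAt c r xs))) c'<len
  at-i : nth (dseq D') c' ≡ nth (dseq D) c' + r
  at-i rewrite dD | dD' =
    trans (nth-addAt-≡ c' r xs c'<len)
          (cong (_+ r) (sym (nth-addAt-≢ c r xs c' (>⇒≢ c<c'))))
  at-j : nth (dseq D) c ≡ nth (dseq D') c + r
  at-j rewrite dD | dD' =
    trans (nth-addAt-≡ c r xs (<-trans c<c' c'<len))
          (cong (_+ r) (sym (nth-addAt-≢ c' r xs c (<⇒≢ c<c'))))
  elsewhere : (h : ℕ) → 1 ≤ h → h ≤ length (dseq D) → h ≢ suc c' → h ≢ suc c → dAt D' h ≡ dAt D h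
  elsewhere (suc t) _ _ t≢c' t≢c rewrite dD | dD' =
    trans (nth-addAt-≢ c' r xs t (λ t≡c' → t≢c' (cong suc t≡c')))
          (sym (nth-addAt-≢ c r xs t (λ t≡c → t≢c (cong suc t≡c))))

moveNs-transfersRight : ∀ A V B r {D D' : Word} →
                        D ≡ A ++ replicate r N ++ V ++ S ∷ B →
                        D' ≡ A ++ V ++ S ∷ replicate r N ++ B →
                        TransfersRight (length (dseq D)) r D D'
moveNs-transfersRight A V B r refl refl =
  addAt-transfersRight (A ++ replicate r N ++ V ++ S ∷ B) (A ++ V ++ S ∷ replicate r N ++ B)
    (dseq (A ++ V ++ S ∷ B))
    (dseq-insertNs A r (V ++ S ∷ B))
    (dseq-++-addAt A (dseq-++-addAt V {c = 1} (cong (0 ∷_) (dseq-replicateN r B))))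
    (m<m+n (countS A) (m≤n+m 1 (countS V)))
    c'<len
  where
  open ≤-Reasoning
  c'<len : countS A + (countS V + 1) < length (dseq (A ++ V ++ S ∷ B))
  c'<len = begin-strict
    countS A + (countS V + 1)                ≤⟨ +-monoʳ-≤ (countS A) (+-monoʳ-≤ (countS V) (s≤s z≤n)) ⟩
    countS A + (countS V + suc (countS B))   ≡⟨ cong (countS A +_) (countS-++ V (S ∷ B)) ⟨
    countS A + countS (V ++ S ∷ B)           ≡⟨ countS-++ A (V ++ S ∷ B) ⟨
    countS (A ++ V ++ S ∷ B)                 <⟨ s≤s ≤-refl ⟩
    suc (countS (A ++ V ++ S ∷ B))           ≡⟨ length-dseq (A ++ V ++ S ∷ B) ⟨
    length (dseq (A ++ V ++ S ∷ B))          ∎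

prefixX : ℕ → List Word → Word
prefixX m Ds₁ = replicate (m ∸ 1) N ++ concatMap (λ w → w ++ (S ∷ [])) Ds₁

compX-moveNs : ∀ m k Ds₁ Dj y ys P Q →
               P ++ compX m k Ds₁ Dj (y ∷ ys) ++ Q ≡
               (P ++ prefixX m Ds₁) ++ replicate (k * (m ∸ 1)) N ++ Dj ++ S ∷ (intercalate (S ∷ []) (y ∷ ys) ++ Q)
compX-moveNs m k Ds₁ Dj y ys P Q =
  solve 8 (λ p n cm r dj s rest q →
             p ⊕ (n ⊕ cm ⊕ r ⊕ dj ⊕ s ⊕ rest) ⊕ q ⊜ (p ⊕ n ⊕ cm) ⊕ r ⊕ dj ⊕ s ⊕ rest ⊕ q) refl
    P (replicate (m ∸ 1) N) (concatMap (λ w → w ++ (S ∷ [])) Ds₁) (replicate (k * (m ∸ 1)) N)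
    Dj (S ∷ []) (intercalate (S ∷ []) (y ∷ ys)) Q

compX'-moveNs : ∀ m k Ds₁ Dj Ds₂ P Q →
                P ++ compX' m k Ds₁ Dj Ds₂ ++ Q ≡
                (P ++ prefixX m Ds₁) ++ Dj ++ S ∷ replicate (k * (m ∸ 1)) N ++ (intercalate (S ∷ []) Ds₂ ++ Q)
compX'-moveNs m k Ds₁ Dj Ds₂ P Q =
  solve 8 (λ p n cm dj s r rest q →
             p ⊕ (n ⊕ cm ⊕ dj ⊕ s ⊕ r ⊕ rest) ⊕ q ⊜ (p ⊕ n ⊕ cm) ⊕ dj ⊕ s ⊕ r ⊕ rest ⊕ q) refl
    P (replicate (m ∸ 1) N) (concatMap (λ w → w ++ (S ∷ [])) Ds₁) Dj (S ∷ [])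
    (replicate (k * (m ∸ 1)) N) (intercalate (S ∷ []) Ds₂) Q

blocks-after-jth : ∀ m {x l l₂} → suc l ≤ m ∸ 1 → l + 1 + l₂ ≡ m + x → l₂ ≢ 0
blocks-after-jth zero    ()
blocks-after-jth (suc m) {x} {l} l<m eq refl = 1+n≰n (begin
  suc m          ≤⟨ m≤m+n (suc m) x ⟩
  suc m + x      ≡⟨ eq ⟨
  l + 1 + 0      ≡⟨ +-identityʳ (l + 1) ⟩
  l + 1          ≡⟨ +-comm l 1 ⟩
  suc l          ≤⟨ l<m ⟩
  m              ∎)
  where open ≤-Reasoning

proposition3p11 : (m k g n : ℕ) → 2 ≤ m → 1 ≤ k → n ≡ m + g * (m ∸ 1) →
    (D D' : Word) → IsDyck m D → IsDyck m D' →
    countS D ≡ n ∸ 1 → countS D' ≡ n ∸ 1 →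
    RightCompression m k D D' →
    Σ ℕ λ j → Σ ℕ λ i → 1 ≤ j × j < i × i ≤ n ×
      dAt D' i ≡ dAt D i + k * (m ∸ 1) ×
      dAt D j ≡ dAt D' j + k * (m ∸ 1) ×
      ((h : ℕ) → 1 ≤ h → h ≤ n → h ≢ i → h ≢ j → dAt D' h ≡ dAt D h)
proposition3p11 m _ _ _ _ _ _ _ _ _ _ _ _ (rc _ _ _ _ [] j≤m-1 len _ _ _ _ _) =
  ⊥-elim (blocks-after-jth m j≤m-1 len refl)
-- Matching n ≡ m + g(m-1) with m ≥ 2 makes suc (n ∸ 1) reduce to n.
proposition3p11 m@(suc (suc _)) k _ _ _ _ refl D D' _ _ countS-D _
  (rc P Q Ds₁ Dj (y ∷ ys) _ _ _ _ _ D≡ D'≡) =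
  subst (λ n → TransfersRight n r D D') (trans (length-dseq D) (cong suc countS-D))
    (moveNs-transfersRight (P ++ prefixX m Ds₁) Dj (intercalate (S ∷ []) (y ∷ ys) ++ Q) r
      (trans D≡ (compX-moveNs m k Ds₁ Dj y ys P Q))
      (trans D'≡ (compX'-moveNs m k Ds₁ Dj (y ∷ ys) P Q)))
  where
  r : ℕ
  r = k * (m ∸ 1)
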